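{- Let $G$ be a finite simple undirected graph and $C_1,C_2\in\mathcal{C}_{\mathcal{R}}$ with $|C_1|=|C_2|$. Then $C_1\sim_{\mathtt{pi}}C_2$ if and only if there exist a finite set $\mathcal{X}$ of cycles with $|C|=|C_1|$ for all $C\in\mathcal{X}$ and $C_1,C_2\notin\mathcal{X}$, and a finite set $\mathcal{Y}$ of cycles with $|C|<|C_1|$ for all $C\in\mathcal{Y}$, such that (1) there exists an MCB $\mathcal{M}$ with $\mathcal{X}\cup\{C_2\}\subseteq\mathcal{M}$, and (2) $C_1=C_2\oplus\bigoplus_{C'\in\mathcal{X}}C'\oplus\bigoplus_{C''\in\mathcal{Y}}C''$. Moreover, in this case the set of cycles of length $|C_1|$ in $\mathcal{E}_{\mathcal{M}}(C_1)$ other than $C_2$ is exactly $\mathcal{X}$.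
   Context: Let $G=(V,E)$ be a finite simple undirected graph. A cycle is a set $C\subseteq E$ such that every vertex of $G$ has even degree in the subgraph with edge set $C$; $|C|$ denotes the number of edges. The cycles form a vector space over $GF(2)$ under symmetric difference $\oplus$. A minimum cycle basis (MCB) is a basis $\mathcal{M}$ of this space minimizing $\sum_{B\in\mathcal{M}}|B|$. The set of relevant cycles $\mathcal{C}_{\mathcal{R}}$ is the union of all MCBs. For a basis $\mathcal{B}$ and a cycle $C$, $\mathcal{E}_{\mathcal{B}}(C)$ denotes the unique subset of $\mathcal{B}$ whose $\oplus$-sum is $C$. For $C_1,C_2\in\mathcal{C}_{\mathcal{R}}$, $C_1\sim_{\mathtt{pi}}C_2$ means there exists an MCB $\mathcal{M}_2$ with $C_2\in\mathcal{M}_2$ such that $(\mathcal{M}_2\setminus\{C_2\})\cup\{C_1\}$ is also an MCB. -}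

module Defs where

open import Data.Nat using (ℕ; _+_; _<_; _≤_)
open import Data.Nat.Divisibility using (_∣_)
open import Data.Bool using (Bool; true; false; _xor_; _∧_; _∨_)
open import Data.Fin using (Fin)
open import Data.Fin.Properties using () renaming (_≟_ to _≟ᶠ_)
open import Data.Fin.Subset using (Subset; ∣_∣) renaming (⊥ to ∅)
open import Data.Vec using (Vec; []; _∷_; zipWith; lookup; _[_]≔_)
open import Data.Vec.Membership.Propositional using () renaming (_∈_ to _∈ᵥ_)
open import Data.List using (List; foldr)
open import Data.List.Membership.Propositional using () renaming (_∈_ to _∈ˡ_; _∉_ to _∉ˡ_)
open import Data.List.Relation.Unary.All using (All)
open import Data.List.Relation.Unary.Unique.Propositional using (Unique)
open import Data.Product using (Σ; ∃; ∃-syntax; _×_)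
open import Data.Sum using (_⊎_)
open import Relation.Binary.PropositionalEquality using (_≡_; _≢_)
open import Relation.Nullary using (¬_)
open import Relation.Nullary.Decidable using (⌊_⌋)

-- A finite simple undirected graph: vertices Fin n, edges Fin m,
-- each edge e joins src e and tgt e (unordered: the orientation is irrelevant).
record Graph : Set where
  field
    n m       : ℕ
    src tgt   : Fin m → Fin n
    loopless  : ∀ e → src e ≢ tgt e
    noParallel : ∀ e f →
      ((src e ≡ src f × tgt e ≡ tgt f) ⊎ (src e ≡ tgt f × tgt e ≡ src f)) → e ≡ f
open Graph public

EdgeSet : Graph → Set
EdgeSet G = Subset (m G)

_⊕_ : ∀ {k} → Subset k → Subset k → Subset k
_⊕_ = zipWith _xor_

incident : (G : Graph) → Fin (m G) → Fin (n G) → Bool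
incident G e v = ⌊ src G e ≟ᶠ v ⌋ ∨ ⌊ tgt G e ≟ᶠ v ⌋

degree : (G : Graph) → EdgeSet G → Fin (n G) → ℕ
degree G C v = ∣ Data.Vec.tabulate (λ e → lookup C e ∧ incident G e v) ∣
  where import Data.Vec

-- cycle (in the sense of the paper: even subgraph)
IsCycle : (G : Graph) → EdgeSet G → Set
IsCycle G C = ∀ v → 2 ∣ degree G C v

⊕-sum : ∀ {k} → List (Subset k) → Subset k
⊕-sum = foldr _⊕_ ∅

sumSel : ∀ {k r} → Vec (Subset k) r → Subset r → Subset k
sumSel []       []          = ∅
sumSel (c ∷ cs) (true ∷ s)  = c ⊕ sumSel cs s
sumSel (c ∷ cs) (false ∷ s) = sumSel cs s

weight : ∀ {k r} → Vec (Subset k) r → ℕ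
weight []       = 0
weight (c ∷ cs) = ∣ c ∣ + weight cs

IsBasis : (G : Graph) → ∀ {r} → Vec (EdgeSet G) r → Set
IsBasis G {r} B =
  (∀ i → IsCycle G (lookup B i)) ×
  (∀ (s : Subset r) → sumSel B s ≡ ∅ → s ≡ ∅) ×
  (∀ C → IsCycle G C → ∃[ s ] sumSel B s ≡ C)

IsMCB : (G : Graph) → ∀ {r} → Vec (EdgeSet G) r → Set
IsMCB G B = IsBasis G B × (∀ r' (B' : Vec (EdgeSet G) r') → IsBasis G B' → weight B ≤ weight B')

IsRelevant : (G : Graph) → EdgeSet G → Set
IsRelevant G C = ∃[ r ] Σ (Vec (EdgeSet G) r) λ M → IsMCB G M × C ∈ᵥ M

-- C1 ~pi C2 : some MCB M2 ∋ C2 such that (M2 \ {C2}) ∪ {C1} is an MCB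
-- (replacing the entry C2 of M2 by C1; entries of a basis are distinct)
PI : (G : Graph) → EdgeSet G → EdgeSet G → Set
PI G C₁ C₂ = ∃[ r ] Σ (Vec (EdgeSet G) r) λ M₂ → Σ (Fin r) λ i →
  IsMCB G M₂ × lookup M₂ i ≡ C₂ × IsMCB G (M₂ [ i ]≔ C₁)

-- The right-hand side data: X, Y finite sets (duplicate-free lists) of cycles
-- and an MCB M with conditions (1) and (2).
Witness : (G : Graph) → EdgeSet G → EdgeSet G →
          List (EdgeSet G) → List (EdgeSet G) → ∀ {r} → Vec (EdgeSet G) r → Set
Witness G C₁ C₂ X Y M =
  Unique X × All (IsCycle G) X × All (λ C → ∣ C ∣ ≡ ∣ C₁ ∣) X × C₁ ∉ˡ X × C₂ ∉ˡ X ×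
  Unique Y × All (IsCycle G) Y × All (λ C → ∣ C ∣ < ∣ C₁ ∣) Y ×
  IsMCB G M × C₂ ∈ᵥ M × (∀ C → C ∈ˡ X → C ∈ᵥ M) ×
  C₁ ≡ (C₂ ⊕ ⊕-sum X) ⊕ ⊕-sum Y

-- C belongs to E_M(D), where s is the (unique, for a basis M) selection with sumSel M s ≡ D
InSel : ∀ {k r} → Vec (Subset k) r → Subset r → Subset k → Set
InSel {r = r} M s C = ∃[ i ] (lookup s i ≡ true × lookup M i ≡ C)

{-# OPTIONS --safe #-}
-- Write C₁ in coordinates s with respect to an MCB M with C₂ = M i. Exchanging a basis element
-- for a combination that uses it yields a basis, so by minimality every element used by a cycle
-- D is at most as long as D. Hence the shorter cycles of Y never use an element of length ∣ C₁ ∣,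
-- and for such an element M j the coefficient of C₁ = C₂ ⊕ ΣX ⊕ ΣY is [ j = i ] xor [ M j ∈ X ].
-- This is the final claim of the theorem; it also shows that C₁ uses C₂, so M [ i ]≔ C₁ is a
-- basis of the same weight, i.e. an MCB. Conversely, if M [ i ]≔ C₁ is a basis then C₁ must use
-- C₂, and sorting E_M(C₁) into C₂, the cycles shorter than C₁ (Y) and the remaining ones (X)
-- gives condition (2).
module Submission where

open import Defs
open import Level using (0ℓ)
open import Algebra.Bundles using (AbelianGroup)
open import Algebra.Structures using (IsAbelianGroup)
import Algebra.Properties.AbelianGroup as AbelianGroupProperties
import Algebra.Properties.CommutativeSemigroup as CommutativeSemigroupProperties
import Algebra.Properties.Monoid as MonoidProperties
open import Data.Nat using (ℕ; _+_; _<_; _≤_; _<?_)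
open import Data.Nat.Properties
  using (module ≤-Reasoning; +-commutativeSemigroup; +-assoc; +-cancelˡ-≤; +-cancelʳ-≡; +-monoˡ-≤;
         <-irrefl; <⇒≱; ≮⇒≥; ≤-antisym)
open import Data.Bool using (Bool; true; false; _xor_; if_then_else_)
open import Data.Bool.Properties using (xor-assoc; xor-comm; xor-identityˡ; xor-identityʳ; xor-same; ¬-not)
  renaming (_≟_ to _≟ᵇ_)
open import Data.Fin using (Fin; zero; suc)
open import Data.Fin.Properties using (suc-injective; 0≢1+n) renaming (_≟_ to _≟ᶠ_)
open import Data.Fin.Subset using (Subset; ∣_∣; ⁅_⁆) renaming (⊥ to ∅; _∈_ to _∈ₛ_)
open import Data.Fin.Subset.Properties using (x∈⁅x⁆; x∈⁅y⁆⇒x≡y; x≢y⇒x∉⁅y⁆)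
open import Data.Vec using (Vec; []; _∷_; lookup; _[_]≔_)
open import Data.Vec.Properties
  using (zipWith-assoc; zipWith-comm; zipWith-identityˡ; zipWith-identityʳ; lookup-zipWith;
         lookup-replicate; lookup∘update; lookup∘update′; []=⇒lookup; lookup⇒[]=; ≡-dec)
open import Data.Vec.Relation.Unary.Any using (index)
open import Data.Vec.Relation.Unary.Any.Properties using (lookup-index)
open import Data.Vec.Membership.Propositional using () renaming (_∈_ to _∈ᵥ_)
open import Data.Vec.Membership.Propositional.Properties using (∈-lookup)
open import Data.List using (List; []; _∷_; filter)
open import Data.List.Properties using (filter-accept; filter-reject; filter-none)
open import Data.List.Membership.Propositional using (_∈_; _∉_)
open import Data.List.Membership.Propositional.Properties using (∈-filter⁺; ∈-filter⁻)
open import Data.List.Relation.Unary.Any using (here; there; any?)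
open import Data.List.Relation.Unary.All as All using (All; []; _∷_)
open import Data.List.Relation.Unary.AllPairs using ([]; _∷_)
open import Data.List.Relation.Unary.Unique.Propositional using (Unique)
import Data.List.Relation.Unary.Unique.Propositional.Properties as Unique
open import Data.Product using (Σ; ∃-syntax; _×_; _,_; proj₁; proj₂)
open import Function using (id; _∘_)
open import Function.Bundles using (_⇔_; mk⇔)
open import Function.Definitions using (Injective)
open import Relation.Binary.Definitions using (DecidableEquality)
open import Relation.Binary.PropositionalEquality
open import Relation.Nullary using (¬_; Dec; yes; no; ¬?; contradiction)
open import Relation.Unary using (Pred; Decidable)

⊕-same : ∀ {k} (a : Subset k) → a ⊕ a ≡ ∅
⊕-same []      = refl
⊕-same (x ∷ a) = cong₂ _∷_ (xor-same x) (⊕-same a)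

⊕-isAbelianGroup : ∀ k → IsAbelianGroup _≡_ (_⊕_ {k}) ∅ id
⊕-isAbelianGroup k = record
  { isGroup = record
    { isMonoid = record
      { isSemigroup = record
        { isMagma = record { isEquivalence = isEquivalence ; ∙-cong = cong₂ _⊕_ }
        ; assoc = zipWith-assoc xor-assoc
        }
      ; identity = zipWith-identityˡ xor-identityˡ , zipWith-identityʳ xor-identityʳ
      }
    ; inverse = ⊕-same , ⊕-same
    ; ⁻¹-cong = id
    }
  ; comm = zipWith-comm xor-comm
  }

⊕-abelianGroup : ℕ → AbelianGroup 0ℓ 0ℓ
⊕-abelianGroup k = record { isAbelianGroup = ⊕-isAbelianGroup k }

module ⊕ {k : ℕ} where
  open AbelianGroup (⊕-abelianGroup k) public
    using (assoc; comm; identityˡ; identityʳ; monoid; commutativeSemigroup)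
  open AbelianGroupProperties (⊕-abelianGroup k) public using (x∙y⁻¹≈ε⇒x≈y; xyx⁻¹≈y)
  open CommutativeSemigroupProperties commutativeSemigroup public
    using (interchange; x∙yz≈y∙xz; xy∙z≈xz∙y)
  open MonoidProperties monoid public using (elimˡ; cancelʳ)

lookup-⊕ : ∀ {k} (a b : Subset k) j → lookup (a ⊕ b) j ≡ lookup a j xor lookup b j
lookup-⊕ a b j = lookup-zipWith _xor_ j a b

lookup-⁅⁆-self : ∀ {r} (i : Fin r) → lookup ⁅ i ⁆ i ≡ true
lookup-⁅⁆-self i = []=⇒lookup (x∈⁅x⁆ i)

lookup-⁅⁆-≢ : ∀ {r} {i j : Fin r} → i ≢ j → lookup ⁅ i ⁆ j ≡ false
lookup-⁅⁆-≢ i≢j = ¬-not (x≢y⇒x∉⁅y⁆ (i≢j ∘ sym) ∘ lookup⇒[]= _ _)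

_≟ₛ_ : ∀ {k} → DecidableEquality (Subset k)
_≟ₛ_ = ≡-dec _≟ᵇ_

⊕-sum-filter : ∀ {k ℓ} {P : Pred (Subset k) ℓ} (P? : Decidable P) xs →
               ⊕-sum xs ≡ ⊕-sum (filter P? xs) ⊕ ⊕-sum (filter (¬? ∘ P?) xs)
⊕-sum-filter P? []       = sym (⊕.identityˡ ∅)
⊕-sum-filter P? (x ∷ xs) with P? x
... | yes _ = trans (cong (x ⊕_) (⊕-sum-filter P? xs)) (sym (⊕.assoc x _ _))
... | no  _ = trans (cong (x ⊕_) (⊕-sum-filter P? xs)) (⊕.x∙yz≈y∙xz x _ _)

⊕-sum-filter-≟ : ∀ {k} {x : Subset k} {xs} → Unique xs → x ∈ xs → ⊕-sum (filter (_≟ₛ x) xs) ≡ x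
⊕-sum-filter-≟ {x = x} {_ ∷ xs} (x∉xs ∷ _) (here refl) = begin
  ⊕-sum (filter (_≟ₛ x) (x ∷ xs)) ≡⟨ cong ⊕-sum (filter-accept (_≟ₛ x) refl) ⟩
  x ⊕ ⊕-sum (filter (_≟ₛ x) xs)   ≡⟨ cong (λ l → x ⊕ ⊕-sum l) (filter-none (_≟ₛ x) (All.map (_∘ sym) x∉xs)) ⟩
  x ⊕ ∅                           ≡⟨ ⊕.identityʳ x ⟩
  x                               ∎
  where open ≡-Reasoning
⊕-sum-filter-≟ {x = x} (y∉ys ∷ u) (there x∈ys) =
  trans (cong ⊕-sum (filter-reject (_≟ₛ x) (All.lookup y∉ys x∈ys))) (⊕-sum-filter-≟ u x∈ys)

⊕-sum-split : ∀ {k ℓ} {P : Pred (Subset k) ℓ} (P? : Decidable P) {x xs} → Unique xs → x ∈ xs → ¬ P x →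
              ⊕-sum xs ≡ (x ⊕ ⊕-sum (filter (¬? ∘ (_≟ₛ x)) (filter (¬? ∘ P?) xs))) ⊕ ⊕-sum (filter P? xs)
⊕-sum-split P? {x} {xs} xs-unique x∈xs ¬Px = begin
  ⊕-sum xs                                ≡⟨ ⊕-sum-filter P? xs ⟩
  ⊕-sum (filter P? xs) ⊕ ⊕-sum R          ≡⟨ cong (⊕-sum (filter P? xs) ⊕_) (⊕-sum-filter (_≟ₛ x) R) ⟩
  ⊕-sum (filter P? xs) ⊕ (⊕-sum (filter (_≟ₛ x) R) ⊕ ⊕-sum R′)
                                          ≡⟨ cong (λ c → ⊕-sum (filter P? xs) ⊕ (c ⊕ ⊕-sum R′)) x-part ⟩
  ⊕-sum (filter P? xs) ⊕ (x ⊕ ⊕-sum R′)   ≡⟨ ⊕.comm _ _ ⟩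
  (x ⊕ ⊕-sum R′) ⊕ ⊕-sum (filter P? xs)   ∎
  where
  open ≡-Reasoning
  R  = filter (¬? ∘ P?) xs
  R′ = filter (¬? ∘ (_≟ₛ x)) R
  x-part : ⊕-sum (filter (_≟ₛ x) R) ≡ x
  x-part = ⊕-sum-filter-≟ (Unique.filter⁺ (¬? ∘ P?) xs-unique) (∈-filter⁺ (¬? ∘ P?) x∈xs ¬Px)

-- For sumSel M s ≡ C, the members of selected M s form the paper's E_M(C).
selected : ∀ {a} {A : Set a} {r} → Vec A r → Subset r → List A
selected []      []          = []
selected (c ∷ M) (true ∷ s)  = c ∷ selected M s
selected (c ∷ M) (false ∷ s) = selected M s

module _ {a} {A : Set a} where

  ∈-selected⁺ : ∀ {r} (M : Vec A r) {s j} → lookup s j ≡ true → lookup M j ∈ selected M s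
  ∈-selected⁺ (c ∷ M) {true ∷ s}  {zero}  _  = here refl
  ∈-selected⁺ (c ∷ M) {true ∷ s}  {suc j} sⱼ = there (∈-selected⁺ M sⱼ)
  ∈-selected⁺ (c ∷ M) {false ∷ s} {suc j} sⱼ = ∈-selected⁺ M sⱼ

  ∈-selected⁻ : ∀ {r} (M : Vec A r) s {x} → x ∈ selected M s → ∃[ j ] lookup s j ≡ true × lookup M j ≡ x
  ∈-selected⁻ []      []          ()
  ∈-selected⁻ (c ∷ M) (true ∷ s)  (here refl) = zero , refl , refl
  ∈-selected⁻ (c ∷ M) (true ∷ s)  (there x∈)  = let j , selects = ∈-selected⁻ M s x∈ in suc j , selects
  ∈-selected⁻ (c ∷ M) (false ∷ s) x∈          = let j , selects = ∈-selected⁻ M s x∈ in suc j , selects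

  selected-unique : ∀ {r} (M : Vec A r) s → Injective _≡_ _≡_ (lookup M) → Unique (selected M s)
  selected-unique []      []          _      = []
  selected-unique (c ∷ M) (true ∷ s)  inj =
    All.tabulate (λ c∈ c≡ → let j , _ , Mⱼ≡ = ∈-selected⁻ M s c∈ in 0≢1+n (inj (trans c≡ (sym Mⱼ≡))))
    ∷ selected-unique M s (suc-injective ∘ inj)
  selected-unique (c ∷ M) (false ∷ s) inj = selected-unique M s (suc-injective ∘ inj)

⊕-sum-selected : ∀ {k r} (M : Vec (Subset k) r) s → ⊕-sum (selected M s) ≡ sumSel M s
⊕-sum-selected []      []          = refl
⊕-sum-selected (c ∷ M) (true ∷ s)  = cong (c ⊕_) (⊕-sum-selected M s)
⊕-sum-selected (c ∷ M) (false ∷ s) = ⊕-sum-selected M s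

module _ {k : ℕ} where

  sumSel-∅ : ∀ {r} (M : Vec (Subset k) r) → sumSel M ∅ ≡ ∅
  sumSel-∅ []      = refl
  sumSel-∅ (c ∷ M) = sumSel-∅ M

  sumSel-⊕ : ∀ {r} (M : Vec (Subset k) r) s t → sumSel M (s ⊕ t) ≡ sumSel M s ⊕ sumSel M t
  sumSel-⊕ []      []          []          = sym (⊕-same ∅)
  sumSel-⊕ (c ∷ M) (true ∷ s)  (true ∷ t)  =
    trans (sumSel-⊕ M s t) (sym (trans (⊕.interchange c _ c _) (⊕.elimˡ (⊕-same c) _)))
  sumSel-⊕ (c ∷ M) (true ∷ s)  (false ∷ t) = trans (cong (c ⊕_) (sumSel-⊕ M s t)) (sym (⊕.assoc c _ _))
  sumSel-⊕ (c ∷ M) (false ∷ s) (true ∷ t)  = trans (cong (c ⊕_) (sumSel-⊕ M s t)) (⊕.x∙yz≈y∙xz c _ _)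
  sumSel-⊕ (c ∷ M) (false ∷ s) (false ∷ t) = sumSel-⊕ M s t

  sumSel-⁅⁆ : ∀ {r} (M : Vec (Subset k) r) i → sumSel M ⁅ i ⁆ ≡ lookup M i
  sumSel-⁅⁆ (c ∷ M) zero    = trans (cong (c ⊕_) (sumSel-∅ M)) (⊕.identityʳ c)
  sumSel-⁅⁆ (c ∷ M) (suc i) = sumSel-⁅⁆ M i

  sumSel-update-outside : ∀ {r} (M : Vec (Subset k) r) i C u → lookup u i ≡ false →
                          sumSel (M [ i ]≔ C) u ≡ sumSel M u
  sumSel-update-outside (c ∷ M) zero    C (false ∷ u) _  = refl
  sumSel-update-outside (c ∷ M) (suc i) C (true ∷ u)  uᵢ = cong (c ⊕_) (sumSel-update-outside M i C u uᵢ)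
  sumSel-update-outside (c ∷ M) (suc i) C (false ∷ u) uᵢ = sumSel-update-outside M i C u uᵢ

  sumSel-update-inside : ∀ {r} (M : Vec (Subset k) r) i C u → lookup u i ≡ true →
                         sumSel (M [ i ]≔ C) u ≡ (sumSel M u ⊕ lookup M i) ⊕ C
  sumSel-update-inside (c ∷ M) zero    C (true ∷ u)  _  =
    sym (trans (cong (_⊕ C) (⊕.xyx⁻¹≈y c _)) (⊕.comm _ C))
  sumSel-update-inside (c ∷ M) (suc i) C (true ∷ u)  uᵢ =
    trans (cong (c ⊕_) (sumSel-update-inside M i C u uᵢ))
          (trans (sym (⊕.assoc c _ C)) (cong (_⊕ C) (sym (⊕.assoc c _ _))))
  sumSel-update-inside (c ∷ M) (suc i) C (false ∷ u) uᵢ = sumSel-update-inside M i C u uᵢ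

  weight-update : ∀ {r} (M : Vec (Subset k) r) i C → weight (M [ i ]≔ C) + ∣ lookup M i ∣ ≡ weight M + ∣ C ∣
  weight-update (c ∷ M) zero    C = xy∙z≈zy∙x (∣ C ∣) (weight M) (∣ c ∣)
    where open CommutativeSemigroupProperties +-commutativeSemigroup
  weight-update (c ∷ M) (suc i) C =
    trans (+-assoc (∣ c ∣) _ _) (trans (cong (∣ c ∣ +_) (weight-update M i C)) (sym (+-assoc (∣ c ∣) _ _)))

  Independent : ∀ {r} → Vec (Subset k) r → Set
  Independent {r} M = ∀ (s : Subset r) → sumSel M s ≡ ∅ → s ≡ ∅

  module _ {r} (M : Vec (Subset k) r) (independent : Independent M) where

    sumSel-injective : ∀ {s t} → sumSel M s ≡ sumSel M t → s ≡ t
    sumSel-injective {s} {t} eq = ⊕.x∙y⁻¹≈ε⇒x≈y s t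
      (independent (s ⊕ t) (trans (sumSel-⊕ M s t) (trans (cong (_⊕ sumSel M t) eq) (⊕-same _))))

    lookup-injective : Injective _≡_ _≡_ (lookup M)
    lookup-injective {i} {j} eq = x∈⁅y⁆⇒x≡y j (subst (i ∈ₛ_) ⁅i⁆≡⁅j⁆ (x∈⁅x⁆ i))
      where
      ⁅i⁆≡⁅j⁆ : ⁅ i ⁆ ≡ ⁅ j ⁆
      ⁅i⁆≡⁅j⁆ = sumSel-injective (trans (sumSel-⁅⁆ M i) (trans eq (sym (sumSel-⁅⁆ M j))))

  -- Coordinates with respect to M [ i ]≔ sumSel M s in terms of those with respect to M; when s
  -- selects i this is an involution, so the updated family is independent and spans the same space.
  exchangeCoords : ∀ {r} → Fin r → Subset r → Subset r → Subset r
  exchangeCoords i s u = if lookup u i then (u ⊕ ⁅ i ⁆) ⊕ s else u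

  module _ {r} (M : Vec (Subset k) r) (i : Fin r) (s : Subset r) where

    sumSel-exchange : ∀ u → sumSel (M [ i ]≔ sumSel M s) u ≡ sumSel M (exchangeCoords i s u)
    sumSel-exchange u with lookup u i in uᵢ
    ... | false = sumSel-update-outside M i _ u uᵢ
    ... | true  = begin
      sumSel (M [ i ]≔ sumSel M s) u                ≡⟨ sumSel-update-inside M i _ u uᵢ ⟩
      (sumSel M u ⊕ lookup M i) ⊕ sumSel M s
        ≡⟨ cong (λ c → (sumSel M u ⊕ c) ⊕ sumSel M s) (sumSel-⁅⁆ M i) ⟨
      (sumSel M u ⊕ sumSel M ⁅ i ⁆) ⊕ sumSel M s    ≡⟨ cong (_⊕ sumSel M s) (sumSel-⊕ M u ⁅ i ⁆) ⟨
      sumSel M (u ⊕ ⁅ i ⁆) ⊕ sumSel M s             ≡⟨ sumSel-⊕ M (u ⊕ ⁅ i ⁆) s ⟨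
      sumSel M ((u ⊕ ⁅ i ⁆) ⊕ s)                    ∎
      where open ≡-Reasoning

    exchangeCoords-involutive : lookup s i ≡ true → ∀ u → exchangeCoords i s (exchangeCoords i s u) ≡ u
    exchangeCoords-involutive sᵢ u with lookup u i in uᵢ
    ... | false = cong (λ b → if b then (u ⊕ ⁅ i ⁆) ⊕ s else u) uᵢ
    ... | true  = begin
      exchangeCoords i s v             ≡⟨ cong (λ b → if b then (v ⊕ ⁅ i ⁆) ⊕ s else v) vᵢ ⟩
      (v ⊕ ⁅ i ⁆) ⊕ s                  ≡⟨ cong (_⊕ s) (⊕.xy∙z≈xz∙y (u ⊕ ⁅ i ⁆) s ⁅ i ⁆) ⟩
      (((u ⊕ ⁅ i ⁆) ⊕ ⁅ i ⁆) ⊕ s) ⊕ s  ≡⟨ ⊕.cancelʳ (⊕-same s) _ ⟩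
      (u ⊕ ⁅ i ⁆) ⊕ ⁅ i ⁆              ≡⟨ ⊕.cancelʳ (⊕-same ⁅ i ⁆) u ⟩
      u                                ∎
      where
      open ≡-Reasoning
      v = (u ⊕ ⁅ i ⁆) ⊕ s
      vᵢ : lookup v i ≡ true
      vᵢ = begin
        lookup v i                                     ≡⟨ lookup-⊕ (u ⊕ ⁅ i ⁆) s i ⟩
        lookup (u ⊕ ⁅ i ⁆) i xor lookup s i            ≡⟨ cong (_xor lookup s i) (lookup-⊕ u ⁅ i ⁆ i) ⟩
        (lookup u i xor lookup ⁅ i ⁆ i) xor lookup s i
          ≡⟨ cong₂ (λ a b → (a xor b) xor lookup s i) uᵢ (lookup-⁅⁆-self i) ⟩
        lookup s i                                     ≡⟨ sᵢ ⟩
        true                                           ∎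

    exchange-independent : Independent M → lookup s i ≡ true → Independent (M [ i ]≔ sumSel M s)
    exchange-independent independent sᵢ u u↦∅ = begin
      u                                             ≡⟨ exchangeCoords-involutive sᵢ u ⟨
      exchangeCoords i s (exchangeCoords i s u)     ≡⟨ cong (exchangeCoords i s) u′≡∅ ⟩
      exchangeCoords i s ∅
        ≡⟨ cong (λ b → if b then (∅ ⊕ ⁅ i ⁆) ⊕ s else ∅) (lookup-replicate i false) ⟩
      ∅                                             ∎
      where
      open ≡-Reasoning
      u′≡∅ : exchangeCoords i s u ≡ ∅
      u′≡∅ = independent _ (trans (sym (sumSel-exchange u)) u↦∅)

    exchange-spans : lookup s i ≡ true → ∀ t → sumSel (M [ i ]≔ sumSel M s) (exchangeCoords i s t) ≡ sumSel M t
    exchange-spans sᵢ t = trans (sumSel-exchange _) (cong (sumSel M) (exchangeCoords-involutive sᵢ t))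

  update-independent⇒selected : ∀ {r} (M : Vec (Subset k) r) i s →
                                Independent (M [ i ]≔ sumSel M s) → lookup s i ≡ true
  update-independent⇒selected M i s independent with lookup s i in sᵢ
  ... | true  = refl
  ... | false = trans (sym sᵢ) (trans (cong (λ t → lookup t i) s≡⁅i⁆) (lookup-⁅⁆-self i))
    where
    s≡⁅i⁆ : s ≡ ⁅ i ⁆
    s≡⁅i⁆ = sumSel-injective (M [ i ]≔ sumSel M s) independent (begin
      sumSel (M [ i ]≔ sumSel M s) s       ≡⟨ sumSel-update-outside M i _ s sᵢ ⟩
      sumSel M s                           ≡⟨ lookup∘update i M (sumSel M s) ⟨
      lookup (M [ i ]≔ sumSel M s) i       ≡⟨ sumSel-⁅⁆ (M [ i ]≔ sumSel M s) i ⟨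
      sumSel (M [ i ]≔ sumSel M s) ⁅ i ⁆   ∎)
      where open ≡-Reasoning

  update-independent⇒lookup≡⇒≡ : ∀ {r} (M : Vec (Subset k) r) i C {j} →
                                  Independent (M [ i ]≔ C) → lookup M j ≡ C → j ≡ i
  update-independent⇒lookup≡⇒≡ M i C {j} independent Mⱼ≡C with j ≟ᶠ i
  ... | yes j≡i = j≡i
  ... | no  j≢i = lookup-injective (M [ i ]≔ C) independent
                    (trans (lookup∘update′ j≢i M C) (trans Mⱼ≡C (sym (lookup∘update i M C))))

  record HasCoord {r} (M : Vec (Subset k) r) (j : Fin r) (b : Bool) (C : Subset k) : Set where
    constructor coords
    field
      coeffs   : Subset r
      sums-to  : sumSel M coeffs ≡ C
      coeff-at : lookup coeffs j ≡ b

  module _ {r} {M : Vec (Subset k) r} {j : Fin r} where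

    HasCoord-unique : ∀ {a b C} → Independent M → HasCoord M j a C → HasCoord M j b C → a ≡ b
    HasCoord-unique independent (coords t t↦C tⱼ) (coords u u↦C uⱼ) =
      trans (sym tⱼ) (trans (cong (λ v → lookup v j) (sumSel-injective M independent (trans t↦C (sym u↦C)))) uⱼ)

    HasCoord-∅ : HasCoord M j false ∅
    HasCoord-∅ = coords ∅ (sumSel-∅ M) (lookup-replicate j false)

    HasCoord-⊕ : ∀ {a b C D} → HasCoord M j a C → HasCoord M j b D → HasCoord M j (a xor b) (C ⊕ D)
    HasCoord-⊕ (coords t t↦C tⱼ) (coords u u↦D uⱼ) =
      coords (t ⊕ u) (trans (sumSel-⊕ M t u) (cong₂ _⊕_ t↦C u↦D)) (trans (lookup-⊕ t u j) (cong₂ _xor_ tⱼ uⱼ))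

    HasCoord-lookup-self : HasCoord M j true (lookup M j)
    HasCoord-lookup-self = coords ⁅ j ⁆ (sumSel-⁅⁆ M j) (lookup-⁅⁆-self j)

    HasCoord-lookup-≢ : ∀ {i} → i ≢ j → HasCoord M j false (lookup M i)
    HasCoord-lookup-≢ {i} i≢j = coords ⁅ i ⁆ (sumSel-⁅⁆ M i) (lookup-⁅⁆-≢ i≢j)

    ∈ᵥ⇒HasCoord-false : ∀ {C} → C ∈ᵥ M → C ≢ lookup M j → HasCoord M j false C
    ∈ᵥ⇒HasCoord-false C∈M C≢Mⱼ = subst (HasCoord M j false) (sym (lookup-index C∈M)) (HasCoord-lookup-≢ k≢j)
      where
      k≢j : index C∈M ≢ j
      k≢j refl = C≢Mⱼ (lookup-index C∈M)

    ⊕-sum-HasCoord-false : ∀ {L} → All (HasCoord M j false) L → HasCoord M j false (⊕-sum L)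
    ⊕-sum-HasCoord-false []       = HasCoord-∅
    ⊕-sum-HasCoord-false (h ∷ hs) = HasCoord-⊕ h (⊕-sum-HasCoord-false hs)

    ∉⇒HasCoord-false : ∀ {L} → (∀ C → C ∈ L → C ∈ᵥ M) → lookup M j ∉ L → HasCoord M j false (⊕-sum L)
    ∉⇒HasCoord-false L⊆M Mⱼ∉L =
      ⊕-sum-HasCoord-false (All.tabulate λ C∈L → ∈ᵥ⇒HasCoord-false (L⊆M _ C∈L) λ { refl → Mⱼ∉L C∈L })

    ∈⇒HasCoord-true : ∀ {L} → Unique L → (∀ C → C ∈ L → C ∈ᵥ M) → lookup M j ∈ L →
                      HasCoord M j true (⊕-sum L)
    ∈⇒HasCoord-true (x∉xs ∷ _) L⊆M (here refl) =
      HasCoord-⊕ HasCoord-lookup-self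
                 (∉⇒HasCoord-false (λ C → L⊆M C ∘ there) λ x∈xs → All.lookup x∉xs x∈xs refl)
    ∈⇒HasCoord-true (x∉xs ∷ u) L⊆M (there Mⱼ∈xs) =
      HasCoord-⊕ (∈ᵥ⇒HasCoord-false (L⊆M _ (here refl)) (All.lookup x∉xs Mⱼ∈xs))
                 (∈⇒HasCoord-true u (λ C → L⊆M C ∘ there) Mⱼ∈xs)

module _ (G : Graph) where

  relevant⇒cycle : ∀ {C} → IsRelevant G C → IsCycle G C
  relevant⇒cycle (_ , _ , ((cycles , _) , _) , C∈M) = subst (IsCycle G) (sym (lookup-index C∈M)) (cycles _)

  module _ {r} (M : Vec (EdgeSet G) r) where

    exchange : IsBasis G M → ∀ {C s i} → IsCycle G C → sumSel M s ≡ C → lookup s i ≡ true →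
               IsBasis G (M [ i ]≔ C)
    exchange (cycles , independent , spans) {C} {i = i} C-cycle refl sᵢ =
      updated-cycles ,
      exchange-independent M i _ independent sᵢ ,
      λ D D-cycle → let t , t↦D = spans D D-cycle in _ , trans (exchange-spans M i _ sᵢ t) t↦D
      where
      updated-cycles : ∀ j → IsCycle G (lookup (M [ i ]≔ C) j)
      updated-cycles j with j ≟ᶠ i
      ... | yes refl = subst (IsCycle G) (sym (lookup∘update i M C)) C-cycle
      ... | no  j≢i  = subst (IsCycle G) (sym (lookup∘update′ j≢i M C)) (cycles j)

    -- Otherwise exchanging M j for D would give a lighter basis.
    mcb-selected-≤ : IsMCB G M → ∀ {D t j} → IsCycle G D → sumSel M t ≡ D → lookup t j ≡ true →
                     ∣ lookup M j ∣ ≤ ∣ D ∣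
    mcb-selected-≤ (basis , minimal) {D} {t} {j} D-cycle t↦D tⱼ = +-cancelˡ-≤ (weight M) _ _ (begin
      weight M + ∣ lookup M j ∣
        ≤⟨ +-monoˡ-≤ _ (minimal _ (M [ j ]≔ D) (exchange basis D-cycle t↦D tⱼ)) ⟩
      weight (M [ j ]≔ D) + ∣ lookup M j ∣  ≡⟨ weight-update M j D ⟩
      weight M + ∣ D ∣                      ∎)
      where open ≤-Reasoning

    mcb-exchange : IsMCB G M → ∀ {C s i} → IsCycle G C → sumSel M s ≡ C → lookup s i ≡ true →
                   ∣ C ∣ ≡ ∣ lookup M i ∣ → IsMCB G (M [ i ]≔ C)
    mcb-exchange (basis , minimal) {C} {i = i} C-cycle s↦C sᵢ |C|≡|Mᵢ| =
      exchange basis C-cycle s↦C sᵢ ,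
      λ r′ B′ B′-basis → subst (_≤ weight B′) (sym same-weight) (minimal r′ B′ B′-basis)
      where
      same-weight : weight (M [ i ]≔ C) ≡ weight M
      same-weight = +-cancelʳ-≡ (∣ C ∣) _ _
        (trans (cong (weight (M [ i ]≔ C) +_) |C|≡|Mᵢ|) (weight-update M i C))

    mcb-shorter⇒HasCoord-false : IsMCB G M → ∀ {D j} → IsCycle G D → ∣ D ∣ < ∣ lookup M j ∣ →
                                 HasCoord M j false D
    mcb-shorter⇒HasCoord-false mcb {D} {j} D-cycle |D|<|Mⱼ| with proj₂ (proj₂ (proj₁ mcb)) D D-cycle
    ... | t , t↦D with lookup t j in tⱼ
    ... | false = coords t t↦D tⱼ
    ... | true  = contradiction (mcb-selected-≤ mcb D-cycle t↦D tⱼ) (<⇒≱ |D|<|Mⱼ|)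

    mcb-selection-witness : IsMCB G M → ∀ {C₁ C₂ i s} → lookup M i ≡ C₂ → ∣ C₁ ∣ ≡ ∣ C₂ ∣ →
                            IsCycle G C₁ → sumSel M s ≡ C₁ → lookup s i ≡ true →
                            (∀ {j} → lookup M j ≡ C₁ → j ≡ i) → ∃[ X ] ∃[ Y ] Witness G C₁ C₂ X Y M
    mcb-selection-witness mcb@((cycles , independent , _) , _) {C₁} {C₂} {i} {s}
                          Mᵢ≡C₂ |C₁|≡|C₂| C₁-cycle s↦C₁ sᵢ C₁-only-at-i =
      X , Y ,
      Unique.filter⁺ (¬? ∘ (_≟ₛ C₂)) (Unique.filter⁺ (¬? ∘ shorter?) L-unique) ,
      All.tabulate (L-cycle ∘ X⊆L) ,
      All.tabulate (λ C∈X → ≤-antisym (L-short (X⊆L C∈X)) (≮⇒≥ (proj₂ (R-member (proj₁ (X-member C∈X)))))) ,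
      (λ C₁∈X → proj₂ (X-member C₁∈X) (C₁∈L⇒C₁≡C₂ (X⊆L C₁∈X))) ,
      (λ C₂∈X → proj₂ (X-member C₂∈X) refl) ,
      Unique.filter⁺ shorter? L-unique ,
      All.tabulate (L-cycle ∘ proj₁ ∘ Y-member) ,
      All.tabulate (proj₂ ∘ Y-member) ,
      mcb ,
      subst (_∈ᵥ M) Mᵢ≡C₂ (∈-lookup i M) ,
      (λ _ → L-∈M ∘ X⊆L) ,
      (begin
        C₁                         ≡⟨ s↦C₁ ⟨
        sumSel M s                 ≡⟨ ⊕-sum-selected M s ⟨
        ⊕-sum L                    ≡⟨ ⊕-sum-split shorter? L-unique C₂∈L (<-irrefl (sym |C₁|≡|C₂|)) ⟩
        (C₂ ⊕ ⊕-sum X) ⊕ ⊕-sum Y   ∎)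
      where
      open ≡-Reasoning
      shorter? : ∀ C → Dec (∣ C ∣ < ∣ C₁ ∣)
      shorter? C = ∣ C ∣ <? ∣ C₁ ∣
      L = selected M s
      Y = filter shorter? L
      R = filter (¬? ∘ shorter?) L
      X = filter (¬? ∘ (_≟ₛ C₂)) R

      Y-member : ∀ {C} → C ∈ Y → C ∈ L × ∣ C ∣ < ∣ C₁ ∣
      Y-member = ∈-filter⁻ shorter? {xs = L}
      R-member : ∀ {C} → C ∈ R → C ∈ L × ¬ ∣ C ∣ < ∣ C₁ ∣
      R-member = ∈-filter⁻ (¬? ∘ shorter?) {xs = L}
      X-member : ∀ {C} → C ∈ X → C ∈ R × C ≢ C₂
      X-member = ∈-filter⁻ (¬? ∘ (_≟ₛ C₂)) {xs = R}
      X⊆L : ∀ {C} → C ∈ X → C ∈ L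
      X⊆L = proj₁ ∘ R-member ∘ proj₁ ∘ X-member

      L-unique : Unique L
      L-unique = selected-unique M s (lookup-injective M independent)
      L-cycle : ∀ {C} → C ∈ L → IsCycle G C
      L-cycle C∈L = let j , _ , Mⱼ≡C = ∈-selected⁻ M s C∈L in subst (IsCycle G) Mⱼ≡C (cycles j)
      L-∈M : ∀ {C} → C ∈ L → C ∈ᵥ M
      L-∈M C∈L = let j , _ , Mⱼ≡C = ∈-selected⁻ M s C∈L in subst (_∈ᵥ M) Mⱼ≡C (∈-lookup j M)
      L-short : ∀ {C} → C ∈ L → ∣ C ∣ ≤ ∣ C₁ ∣
      L-short C∈L = let j , sⱼ , Mⱼ≡C = ∈-selected⁻ M s C∈L in
        subst (λ D → ∣ D ∣ ≤ ∣ C₁ ∣) Mⱼ≡C (mcb-selected-≤ mcb C₁-cycle s↦C₁ sⱼ)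
      C₁∈L⇒C₁≡C₂ : C₁ ∈ L → C₁ ≡ C₂
      C₁∈L⇒C₁≡C₂ C₁∈L = let j , _ , Mⱼ≡C₁ = ∈-selected⁻ M s C₁∈L in
        trans (sym Mⱼ≡C₁) (trans (cong (lookup M) (C₁-only-at-i Mⱼ≡C₁)) Mᵢ≡C₂)
      C₂∈L : C₂ ∈ L
      C₂∈L = subst (_∈ L) Mᵢ≡C₂ (∈-selected⁺ M sᵢ)

  module _ {C₁ C₂ : EdgeSet G} {X Y : List (EdgeSet G)} {r} (M : Vec (EdgeSet G) r) where

    witness-coord : Witness G C₁ C₂ X Y M → ∀ {j a b} → ∣ C₁ ∣ ≡ ∣ lookup M j ∣ →
                    HasCoord M j a C₂ → HasCoord M j b (⊕-sum X) → HasCoord M j (a xor b) C₁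
    witness-coord (_ , _ , _ , _ , _ , _ , Y-cycles , Y-shorter , mcb , _ , _ , C₁≡) {j} |C₁|≡|Mⱼ| h₂ hX =
      subst₂ (HasCoord M j) (xor-identityʳ _) (sym C₁≡) (HasCoord-⊕ (HasCoord-⊕ h₂ hX) hY)
      where
      hY : HasCoord M j false (⊕-sum Y)
      hY = ⊕-sum-HasCoord-false (All.zipWith
        (λ (C-cycle , |C|<|C₁|) → mcb-shorter⇒HasCoord-false M mcb C-cycle (subst (_ <_) |C₁|≡|Mⱼ| |C|<|C₁|))
        (Y-cycles , Y-shorter))

    module _ {i} (Mᵢ≡C₂ : lookup M i ≡ C₂) where

      witness-coord-C₂ : Witness G C₁ C₂ X Y M → ∣ C₁ ∣ ≡ ∣ C₂ ∣ → HasCoord M i true C₁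
      witness-coord-C₂ w@(_ , _ , _ , _ , C₂∉X , _ , _ , _ , _ , _ , X⊆M , _) |C₁|≡|C₂| =
        witness-coord w (trans |C₁|≡|C₂| (cong ∣_∣ (sym Mᵢ≡C₂)))
          (subst (HasCoord M i true) Mᵢ≡C₂ HasCoord-lookup-self)
          (∉⇒HasCoord-false X⊆M (C₂∉X ∘ subst (_∈ X) Mᵢ≡C₂))

      witness-coord-∈X : Witness G C₁ C₂ X Y M → ∀ {j} → lookup M j ∈ X → HasCoord M j true C₁
      witness-coord-∈X w@(X-unique , _ , X-lengths , _ , C₂∉X , _ , _ , _ , _ , _ , X⊆M , _) {j} Mⱼ∈X =
        witness-coord w (sym (All.lookup X-lengths Mⱼ∈X))
          (subst (HasCoord M j false) Mᵢ≡C₂ (HasCoord-lookup-≢ i≢j))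
          (∈⇒HasCoord-true X-unique X⊆M Mⱼ∈X)
        where
        i≢j : i ≢ j
        i≢j refl = C₂∉X (subst (_∈ X) Mᵢ≡C₂ Mⱼ∈X)

      witness-coord-∉X : Witness G C₁ C₂ X Y M → ∀ {j} → i ≢ j → ∣ C₁ ∣ ≡ ∣ lookup M j ∣ →
                         lookup M j ∉ X → HasCoord M j false C₁
      witness-coord-∉X w@(_ , _ , _ , _ , _ , _ , _ , _ , _ , _ , X⊆M , _) {j} i≢j |C₁|≡|Mⱼ| Mⱼ∉X =
        witness-coord w |C₁|≡|Mⱼ|
          (subst (HasCoord M j false) Mᵢ≡C₂ (HasCoord-lookup-≢ i≢j))
          (∉⇒HasCoord-false X⊆M Mⱼ∉X)

  witness-X-characterisation : ∀ {C₁ C₂ X Y r} (M : Vec (EdgeSet G) r) → Witness G C₁ C₂ X Y M →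
                    ∀ {s} → sumSel M s ≡ C₁ → ∀ C → (InSel M s C × ∣ C ∣ ≡ ∣ C₁ ∣ × C ≢ C₂) ⇔ C ∈ X
  witness-X-characterisation {C₁} {C₂} {X} M
    w@(_ , _ , X-lengths , _ , C₂∉X , _ , _ , _ , ((_ , independent , _) , _) , C₂∈M , X⊆M , _) {s} s↦C₁ C =
    mk⇔ to from
    where
    i = index C₂∈M
    Mᵢ≡C₂ : lookup M i ≡ C₂
    Mᵢ≡C₂ = sym (lookup-index C₂∈M)

    s-coeff : ∀ {j b} → HasCoord M j b C₁ → lookup s j ≡ b
    s-coeff = HasCoord-unique independent (coords s s↦C₁ refl)

    to : InSel M s C × ∣ C ∣ ≡ ∣ C₁ ∣ × C ≢ C₂ → C ∈ X
    to ((j , sⱼ , Mⱼ≡C) , |C|≡|C₁| , C≢C₂) with any? (C ≟ₛ_) X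
    ... | yes C∈X = C∈X
    ... | no  C∉X = contradiction (trans (sym sⱼ) (s-coeff Mⱼ-coeff)) λ ()
      where
      i≢j : i ≢ j
      i≢j refl = C≢C₂ (trans (sym Mⱼ≡C) Mᵢ≡C₂)
      Mⱼ-coeff : HasCoord M j false C₁
      Mⱼ-coeff = witness-coord-∉X M Mᵢ≡C₂ w i≢j (sym (trans (cong ∣_∣ Mⱼ≡C) |C|≡|C₁|))
                                  (C∉X ∘ subst (_∈ X) Mⱼ≡C)

    from : C ∈ X → InSel M s C × ∣ C ∣ ≡ ∣ C₁ ∣ × C ≢ C₂
    from C∈X = (k , s-coeff (witness-coord-∈X M Mᵢ≡C₂ w (subst (_∈ X) C≡Mₖ C∈X)) , sym C≡Mₖ) ,
               All.lookup X-lengths C∈X ,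
               λ { refl → C₂∉X C∈X }
      where
      k = index (X⊆M C C∈X)
      C≡Mₖ : C ≡ lookup M k
      C≡Mₖ = lookup-index (X⊆M C C∈X)

  Witness⇒PI : ∀ {C₁ C₂} → IsCycle G C₁ → ∣ C₁ ∣ ≡ ∣ C₂ ∣ →
               (∃[ X ] ∃[ Y ] ∃[ r ] Σ (Vec (EdgeSet G) r) λ M → Witness G C₁ C₂ X Y M) → PI G C₁ C₂
  Witness⇒PI {C₁} {C₂} C₁-cycle |C₁|≡|C₂| (_ , _ , r , M , w@(_ , _ , _ , _ , _ , _ , _ , _ , mcb , C₂∈M , _ , _)) =
    r , M , i , mcb , Mᵢ≡C₂ ,
    mcb-exchange M mcb C₁-cycle s↦C₁ sᵢ (trans |C₁|≡|C₂| (cong ∣_∣ (sym Mᵢ≡C₂)))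
    where
    i = index C₂∈M
    Mᵢ≡C₂ : lookup M i ≡ C₂
    Mᵢ≡C₂ = sym (lookup-index C₂∈M)
    open HasCoord (witness-coord-C₂ M Mᵢ≡C₂ w |C₁|≡|C₂|) renaming (sums-to to s↦C₁; coeff-at to sᵢ)

  PI⇒Witness : ∀ {C₁ C₂} → ∣ C₁ ∣ ≡ ∣ C₂ ∣ → PI G C₁ C₂ →
               ∃[ X ] ∃[ Y ] ∃[ r ] Σ (Vec (EdgeSet G) r) λ M → Witness G C₁ C₂ X Y M
  PI⇒Witness {C₁} |C₁|≡|C₂|
    (r , M , i , mcb@((_ , _ , spans) , _) , Mᵢ≡C₂ , ((cycles′ , independent′ , _) , _)) =
    let X , Y , w = mcb-selection-witness M mcb Mᵢ≡C₂ |C₁|≡|C₂| C₁-cycle s↦C₁ sᵢ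
                      (update-independent⇒lookup≡⇒≡ M i C₁ independent′)
    in X , Y , r , M , w
    where
    C₁-cycle : IsCycle G C₁
    C₁-cycle = subst (IsCycle G) (lookup∘update i M C₁) (cycles′ i)
    s = proj₁ (spans C₁ C₁-cycle)
    s↦C₁ : sumSel M s ≡ C₁
    s↦C₁ = proj₂ (spans C₁ C₁-cycle)
    sᵢ : lookup s i ≡ true
    sᵢ = update-independent⇒selected M i s (subst (λ C → Independent (M [ i ]≔ C)) (sym s↦C₁) independent′)

lemma12 : (G : Graph) (C₁ C₂ : EdgeSet G) →
    IsRelevant G C₁ → IsRelevant G C₂ → ∣ C₁ ∣ ≡ ∣ C₂ ∣ →
    (PI G C₁ C₂ ⇔
      (∃[ X ] ∃[ Y ] ∃[ r ] Σ (Vec (EdgeSet G) r) λ M → Witness G C₁ C₂ X Y M))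
    × (∀ X Y r (M : Vec (EdgeSet G) r) → Witness G C₁ C₂ X Y M →
         ∀ (s : Subset r) → sumSel M s ≡ C₁ →
         ∀ C → ((InSel M s C × ∣ C ∣ ≡ ∣ C₁ ∣ × C ≢ C₂) ⇔ C ∈ X))
lemma12 G C₁ C₂ C₁-relevant _ |C₁|≡|C₂| =
  mk⇔ (PI⇒Witness G |C₁|≡|C₂|) (Witness⇒PI G (relevant⇒cycle G C₁-relevant) |C₁|≡|C₂|) ,
  λ _ _ _ M w _ s↦C₁ → witness-X-characterisation G M w s↦C₁
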